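{- Let $r$ be a positive integer and let $F:\mathbf{Set}^r\to\mathbf{Set}$ be a decomposable $r$-sort species with composition operator $\eta$. Let $\Omega\ne\boldsymbol\emptyset$ be an object of $\mathbf{Set}^r$, fix a base point $(\omega,\rho)\in\Omega$, and let $k\ge1$. Then \[ F^{(k)}_\eta[\Omega]=\coprod_{\Omega_1:\ (\omega,\rho)\in\Omega_1\subseteq\Omega}\eta\big(F_\eta[\Omega_1]\times F^{(k-1)}_\eta[\Omega-\Omega_1]\big), \] where the union is a disjoint union.
   Context: $\mathbf{Set}$ is the category of finite sets and bijections. Objects of $\mathbf{Set}^r$ are $r$-tuples $\Omega=(\Omega^{(1)},\dots,\Omega^{(r)})$ of finite sets; set operations are componentwise, and $\boldsymbol\emptyset=(\emptyset,\dots,\emptyset)$. $(\omega,\rho)\in\Omega$ means $\rho\in\{1,\dots,r\}$ and $\omega\in\Omega^{(\rho)}$. An $r$-sort species is a functor $F:\mathbf{Set}^r\to\mathbf{Set}$. A composition operator for $F$ is a family of injective maps $\eta_{(\Omega_1,\Omega_2)}:F[\Omega_1]\times F[\Omega_2]\to F[\Omega_1\amalg\Omega_2]$, one for each disjoint pair, with the following two properties. - Naturality: $\eta_{(\tilde\Omega_1,\tilde\Omega_2)}\circ(F[f_1]\times F[f_2])=F[f_1\amalg f_2]\circ\eta_{(\Omega_1,\Omega_2)}$ for tuples of bijections $f_i:\Omega_i\to\tilde\Omega_i$. - Axiom (D1): whenever $\Omega_1\amalg\Omega_2=\Omega=\tilde\Omega_1\amalg\tilde\Omega_2$, \[ \eta(F[\Omega_1]\times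 F[\Omega_2])\cap\eta(F[\tilde\Omega_1]\times F[\tilde\Omega_2])=\eta(\eta(F[\Omega_{11}]\times F[\Omega_{12}])\times\eta(F[\Omega_{21}]\times F[\Omega_{22}])), \] where $\Omega_{ij}=\Omega_i\cap\tilde\Omega_j$. $\eta(A\times B)$ denotes the image under the relevant $\eta$-map. $F$ is decomposable if some $F[\Omega]\ne\emptyset$ and $F$ admits a composition operator. Define $F_\eta[\boldsymbol\emptyset]=\emptyset$ and, for $\Omega\neq\boldsymbol\emptyset$, $F_\eta[\Omega]=F[\Omega]-\bigcup\eta(F[I]\times F[J])$, the union over disjoint pairs with $I\amalg J=\Omega$ and $I\ne\boldsymbol\emptyset\ne J$. Define $F^{(0)}_\eta[\boldsymbol\emptyset]=F[\boldsymbol\emptyset]$ and $F^{(0)}_\eta[\Omega]=\emptyset$ otherwise. For $k\ge1$, define $F^{(k)}_\eta[\Omega]=\bigcup_{\Omega_1\subseteq\Omega}\eta(F_\eta[\Omega_1]\times F^{(k-1)}_\eta[\Omega-\Omega_1])$. -}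

module Defs where

open import Level using (0ℓ) renaming (suc to lsuc)
open import Data.Nat using (ℕ; zero; suc; _<_)
open import Data.Fin using (Fin)
open import Data.Bool using (Bool; true; false; T; _∧_; _∨_; not)
open import Data.Product using (Σ; Σ-syntax; ∃; ∃-syntax; _×_; _,_; proj₁; proj₂)
open import Data.Unit using (⊤)
open import Data.Empty using (⊥)
open import Relation.Nullary using (¬_)
open import Relation.Binary.PropositionalEquality using (_≡_)
open import Function.Bundles using (_↔_; Inverse)
open import Function.Construct.Identity using (↔-id)
open import Function.Construct.Composition using (_↔-∘_)

-- Labels are natural numbers: an object Ω = (Ω^(1),…,Ω^(r)) is an
-- r-tuple of finite subsets of ℕ, given by (decidable) membership
-- functions together with a bound witnessing finiteness.
-- (Every finite set is in bijection with a finite subset of ℕ, so this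
-- full subcategory of Set^r is equivalent to Set^r.)

record Obj (r : ℕ) : Set where
  constructor mkObj
  field
    mem     : Fin r → ℕ → Bool
    bound   : ℕ
    bounded : ∀ ρ ω → T (mem ρ ω) → ω < bound
open Obj public

module _ {r : ℕ} where

  _∈ₒ_ : ℕ × Fin r → Obj r → Set
  (ω , ρ) ∈ₒ Ω = T (mem Ω ρ ω)

  _≐_ : Obj r → Obj r → Set
  Ω ≐ Ω' = ∀ ρ ω → mem Ω ρ ω ≡ mem Ω' ρ ω

  _⊆ₒ_ : Obj r → Obj r → Set
  Ω ⊆ₒ Ω' = ∀ ρ ω → T (mem Ω ρ ω) → T (mem Ω' ρ ω)

  IsEmpty : Obj r → Set
  IsEmpty Ω = ∀ ρ ω → ¬ T (mem Ω ρ ω)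

  Disjoint : Obj r → Obj r → Set
  Disjoint Ω₁ Ω₂ = ∀ ρ ω → T (mem Ω₁ ρ ω) → T (mem Ω₂ ρ ω) → ⊥

  record DisjUnion (Ω₁ Ω₂ Ω : Obj r) : Set where
    constructor mkDU
    field
      disj  : Disjoint Ω₁ Ω₂
      union : ∀ ρ ω → mem Ω ρ ω ≡ (mem Ω₁ ρ ω ∨ mem Ω₂ ρ ω)

  _∩ₒ_ : Obj r → Obj r → Obj r
  Ω₁ ∩ₒ Ω₂ = mkObj (λ ρ ω → mem Ω₁ ρ ω ∧ mem Ω₂ ρ ω) (bound Ω₁)
                   (λ ρ ω p → bounded Ω₁ ρ ω (∧-l (mem Ω₁ ρ ω) p))
    where
    ∧-l : ∀ a {b} → T (a ∧ b) → T a
    ∧-l true  _ = _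
    ∧-l false ()

  _-ₒ_ : Obj r → Obj r → Obj r
  Ω -ₒ Ω₁ = mkObj (λ ρ ω → mem Ω ρ ω ∧ not (mem Ω₁ ρ ω)) (bound Ω)
                  (λ ρ ω p → bounded Ω ρ ω (∧-l (mem Ω ρ ω) p))
    where
    ∧-l : ∀ a {b} → T (a ∧ b) → T a
    ∧-l true  _ = _
    ∧-l false ()

  Elem : Obj r → Fin r → Set
  Elem Ω ρ = Σ ℕ (λ ω → T (mem Ω ρ ω))

  record Hom (Ω Ω' : Obj r) : Set where
    constructor mkHom
    field
      comp : (ρ : Fin r) → Elem Ω ρ ↔ Elem Ω' ρ

  app : ∀ {Ω Ω'} → Hom Ω Ω' → (ρ : Fin r) → Elem Ω ρ → Elem Ω' ρ
  app f ρ = Inverse.to (Hom.comp f ρ)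

  idH : (Ω : Obj r) → Hom Ω Ω
  idH Ω = mkHom (λ ρ → ↔-id (Elem Ω ρ))

  _∘H_ : ∀ {Ω Ω' Ω''} → Hom Ω' Ω'' → Hom Ω Ω' → Hom Ω Ω''
  g ∘H f = mkHom (λ ρ → Hom.comp g ρ ↔-∘ Hom.comp f ρ)

  _≈H_ : ∀ {Ω Ω'} → Hom Ω Ω' → Hom Ω Ω' → Set
  f ≈H g = ∀ ρ e → app f ρ e ≡ app g ρ e

  -- g : Ω → Ω' restricts on the sub-tuple Ω₁ to f : Ω₁ → Ω₁'
  -- (used to express g = f₁ ∐ f₂ without constructing f₁ ∐ f₂)
  Restricts : ∀ {Ω Ω' Ω₁ Ω₁'} → Hom Ω Ω' → Hom Ω₁ Ω₁' → Set
  Restricts {Ω} {Ω'} {Ω₁} g f =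
    ∀ ρ ω (p : T (mem Ω₁ ρ ω)) (q : T (mem Ω ρ ω)) →
      proj₁ (app g ρ (ω , q)) ≡ proj₁ (app f ρ (ω , p))

record Species (r : ℕ) : Set₁ where
  field
    F₀     : Obj r → Set
    F₁     : ∀ {Ω Ω'} → Hom Ω Ω' → F₀ Ω → F₀ Ω'
    F-id   : ∀ {Ω} (x : F₀ Ω) → F₁ (idH Ω) x ≡ x
    F-∘    : ∀ {Ω Ω' Ω''} (f : Hom Ω Ω') (g : Hom Ω' Ω'') (x : F₀ Ω) →
             F₁ (g ∘H f) x ≡ F₁ g (F₁ f x)
    F-cong : ∀ {Ω Ω'} {f g : Hom Ω Ω'} → f ≈H g → ∀ x → F₁ f x ≡ F₁ g x
    F-fin  : ∀ Ω → Σ[ n ∈ ℕ ] (F₀ Ω ↔ Fin n)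

module _ {r : ℕ} (S : Species r) where
  open Species S

  record CompOp : Set₁ where
    field
      η     : ∀ {Ω₁ Ω₂ Ω : Obj r} → DisjUnion Ω₁ Ω₂ Ω → F₀ Ω₁ → F₀ Ω₂ → F₀ Ω
    Img : ∀ {Ω₁ Ω₂ Ω : Obj r} → DisjUnion Ω₁ Ω₂ Ω →
          (F₀ Ω₁ → Set) → (F₀ Ω₂ → Set) → F₀ Ω → Set
    Img {Ω₁} {Ω₂} u A B z = Σ[ a ∈ F₀ Ω₁ ] Σ[ b ∈ F₀ Ω₂ ] (A a × B b × z ≡ η u a b)
    field
      η-inj : ∀ {Ω₁ Ω₂ Ω : Obj r} (u : DisjUnion Ω₁ Ω₂ Ω) {a a' b b'} →
              η u a b ≡ η u a' b' → a ≡ a' × b ≡ b'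
      η-nat : ∀ {Ω₁ Ω₂ Ω Ω₁' Ω₂' Ω' : Obj r}
              (u : DisjUnion Ω₁ Ω₂ Ω) (u' : DisjUnion Ω₁' Ω₂' Ω')
              (f₁ : Hom Ω₁ Ω₁') (f₂ : Hom Ω₂ Ω₂') (g : Hom Ω Ω') →
              Restricts g f₁ → Restricts g f₂ →
              ∀ a b → η u' (F₁ f₁ a) (F₁ f₂ b) ≡ F₁ g (η u a b)
      -- axiom (D1); the inner splittings u₁ : Ω₁ = Ω₁₁ ∐ Ω₁₂ and
      -- u₂ : Ω₂ = Ω₂₁ ∐ Ω₂₂ always exist, and are quantified over.
      D1 : ∀ {Ω₁ Ω₂ Ω₁' Ω₂' Ω : Obj r}
           (u : DisjUnion Ω₁ Ω₂ Ω) (u' : DisjUnion Ω₁' Ω₂' Ω)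
           (u₁ : DisjUnion (Ω₁ ∩ₒ Ω₁') (Ω₁ ∩ₒ Ω₂') Ω₁)
           (u₂ : DisjUnion (Ω₂ ∩ₒ Ω₁') (Ω₂ ∩ₒ Ω₂') Ω₂) (z : F₀ Ω) →
           ((Img u (λ _ → ⊤) (λ _ → ⊤) z × Img u' (λ _ → ⊤) (λ _ → ⊤) z) →
              Img u (Img u₁ (λ _ → ⊤) (λ _ → ⊤)) (Img u₂ (λ _ → ⊤) (λ _ → ⊤)) z)
           × (Img u (Img u₁ (λ _ → ⊤) (λ _ → ⊤)) (Img u₂ (λ _ → ⊤) (λ _ → ⊤)) z →
              (Img u (λ _ → ⊤) (λ _ → ⊤) z × Img u' (λ _ → ⊤) (λ _ → ⊤) z))

  module _ (C : CompOp) where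
    open CompOp C

    ImgAny : (Ω₁ Ω₂ Ω : Obj r) → (F₀ Ω₁ → Set) → (F₀ Ω₂ → Set) → F₀ Ω → Set
    ImgAny Ω₁ Ω₂ Ω A B z = Σ[ u ∈ DisjUnion Ω₁ Ω₂ Ω ] Img u A B z

    Fη : (Ω : Obj r) → F₀ Ω → Set
    Fη Ω z = ¬ IsEmpty Ω ×
             ¬ (Σ[ I ∈ Obj r ] Σ[ J ∈ Obj r ]
                  (¬ IsEmpty I × ¬ IsEmpty J × ImgAny I J Ω (λ _ → ⊤) (λ _ → ⊤) z))

    Fk : ℕ → (Ω : Obj r) → F₀ Ω → Set
    Fk zero    Ω z = IsEmpty Ω
    Fk (suc k) Ω z = Σ[ Ω₁ ∈ Obj r ]
                     (Ω₁ ⊆ₒ Ω × ImgAny Ω₁ (Ω -ₒ Ω₁) Ω (Fη Ω₁) (Fk k (Ω -ₒ Ω₁)) z)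

module Submission where

-- η is not assumed associative, so factors of different decompositions cannot
-- be compared directly.  Instead an element x ∈ F[X] is described by its
-- splittings: the pairs X = P ∐ Q with x ∈ η(F[P] × F[Q]).
--   * Axiom (D1) says that x = η(a, b) splits along P ∐ Q iff a and b split
--     along the traces of P and Q (η-restrict, η-profile, η-profile₃).
--   * F[∅] is inhabited and y ↦ η(e₀, y) is an injective endomap of a finite
--     set, so every element splits along ∅ ∐ Y.  Hence the splittings of a
--     factor are determined by those of the product (profileˡ, profileʳ), and
--     F_η, F^(k)_η only depend on splittings (Fη-⊑, Fk-≋).
--   * Regrouping: η(a, η(a', b')) and η(a', η(a, b')) have the same
--     splittings, which moves the factor containing the base point to the front.
-- Covering then follows by induction on k, and disjointness from (D1) and the
-- indecomposability of the first factor.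

open import Defs
open import Data.Nat using (ℕ; zero; suc; _<_)
open import Data.Nat.Properties using (1+n≰n)
open import Data.Fin using (Fin; punchOut)
open import Data.Fin.Properties using (any?; punchOut-injective; injective⇒≤; _≟_)
open import Data.Bool using (true; false; T; T?)
open import Data.Bool.Properties using (T-irrelevant; T-∨)
open import Data.Product using (Σ-syntax; _×_; _,_; proj₁; proj₂)
open import Data.Product.Properties using (×-≡,≡→≡; ,-injectiveˡ; ,-injectiveʳ)
open import Data.Product.Function.NonDependent.Propositional using (_×-⇔_)
open import Data.Sum using (_⊎_; inj₁; inj₂; [_,_]; swap)
import Data.Sum as Sum
open import Data.Unit using (⊤; tt)
open import Data.Empty using (⊥-elim)
open import Relation.Nullary using (¬_; yes; no)
open import Relation.Binary.PropositionalEquality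
  using (_≡_; refl; sym; trans; cong; subst; module ≡-Reasoning)
open import Function using (_∘_; id)
open import Function.Bundles using (_↔_; Inverse; mk↔ₛ′; _⇔_; mk⇔; Equivalence)
open import Function.Definitions using (Injective)
open import Function.Construct.Composition using (_⇔-∘_)
open import Function.Construct.Symmetry using (⇔-sym)
open import Function.Construct.Identity using (⇔-id)
open Equivalence using (to; from)

Fin-injective⇒surjective : ∀ n (f : Fin n → Fin n) → Injective _≡_ _≡_ f →
                           ∀ y → Σ[ x ∈ Fin n ] f x ≡ y
Fin-injective⇒surjective zero    f f-inj ()
Fin-injective⇒surjective (suc n) f f-inj y with any? (λ x → f x ≟ y)
... | yes hit = hit
... | no miss = ⊥-elim (1+n≰n (injective⇒≤ {f = g} g-inj))
  where
  -- if y were missed, f would induce an injection Fin (suc n) → Fin n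
  g : Fin (suc n) → Fin n
  g x = punchOut {i = y} {j = f x} (λ y≡fx → miss (x , sym y≡fx))

  g-inj : Injective _≡_ _≡_ g
  g-inj {x} {x'} =
    f-inj ∘ punchOut-injective (λ e → miss (x , sym e)) (λ e → miss (x' , sym e))

finite-injective⇒surjective : {A : Set} {n : ℕ} → A ↔ Fin n → (f : A → A) →
                              Injective _≡_ _≡_ f → ∀ y → Σ[ x ∈ A ] f x ≡ y
finite-injective⇒surjective {A} {n} A↔Fin f f-inj y = ι.from (proj₁ hit) , ι-to-inj (proj₂ hit)
  where
  module ι = Inverse A↔Fin

  ι-to-inj : Injective _≡_ _≡_ ι.to
  ι-to-inj {a} {b} e =
    trans (sym (ι.strictlyInverseʳ a)) (trans (cong ι.from e) (ι.strictlyInverseʳ b))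

  ι-from-inj : Injective _≡_ _≡_ ι.from
  ι-from-inj {i} {j} e =
    trans (sym (ι.strictlyInverseˡ i)) (trans (cong ι.to e) (ι.strictlyInverseˡ j))

  h : Fin n → Fin n
  h = ι.to ∘ f ∘ ι.from

  hit : Σ[ i ∈ Fin n ] h i ≡ ι.to y
  hit = Fin-injective⇒surjective n h (ι-from-inj ∘ f-inj ∘ ι-to-inj) (ι.to y)

T-ext : ∀ {a b} → (T a → T b) → (T b → T a) → a ≡ b
T-ext {false} {false} _ _ = refl
T-ext {false} {true}  _ g = ⊥-elim (g tt)
T-ext {true}  {false} f _ = ⊥-elim (f tt)
T-ext {true}  {true}  _ _ = refl

module _ {r : ℕ} where

  private variable
    A B D P Q P' Q' X X' Y : Obj r

  -- Equality of objects as sets.  It is a record rather than a pair of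
  -- inclusions so that both objects can be recovered by type inference.
  infix 4 _≅_
  record _≅_ (X Y : Obj r) : Set where
    constructor ≅-intro
    field
      ⊆→ : X ⊆ₒ Y
      ⊆← : Y ⊆ₒ X
  open _≅_ public

  ≅-refl : X ≅ X
  ≅-refl = ≅-intro (λ _ _ → id) (λ _ _ → id)

  ≅-sym : X ≅ Y → Y ≅ X
  ≅-sym (≅-intro X⊆Y Y⊆X) = ≅-intro Y⊆X X⊆Y

  ≅⇒≐ : X ≅ Y → X ≐ Y
  ≅⇒≐ e ρ ω = T-ext (⊆→ e ρ ω) (⊆← e ρ ω)

  -- The objects are explicit: they cannot be inferred from truth values.
  ∈∩ : ∀ (X Y : Obj r) {ρ ω} → (ω , ρ) ∈ₒ X → (ω , ρ) ∈ₒ Y → (ω , ρ) ∈ₒ (X ∩ₒ Y)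
  ∈∩ X Y {ρ} {ω} x y with mem X ρ ω
  ... | true = y

  ∈∩ˡ : ∀ (X Y : Obj r) {ρ ω} → (ω , ρ) ∈ₒ (X ∩ₒ Y) → (ω , ρ) ∈ₒ X
  ∈∩ˡ X Y {ρ} {ω} xy with mem X ρ ω
  ... | true = tt

  ∈∩ʳ : ∀ (X Y : Obj r) {ρ ω} → (ω , ρ) ∈ₒ (X ∩ₒ Y) → (ω , ρ) ∈ₒ Y
  ∈∩ʳ X Y {ρ} {ω} xy with mem X ρ ω
  ... | true = xy

  ∈∖ : ∀ (X Y : Obj r) {ρ ω} → (ω , ρ) ∈ₒ X → ¬ (ω , ρ) ∈ₒ Y → (ω , ρ) ∈ₒ (X -ₒ Y)
  ∈∖ X Y {ρ} {ω} x y∉ with mem X ρ ω | mem Y ρ ω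
  ... | true | false = tt
  ... | true | true  = y∉ tt

  ∈∖ˡ : ∀ (X Y : Obj r) {ρ ω} → (ω , ρ) ∈ₒ (X -ₒ Y) → (ω , ρ) ∈ₒ X
  ∈∖ˡ X Y {ρ} {ω} x-y with mem X ρ ω
  ... | true = tt

  ∉∖ : ∀ (X Y : Obj r) {ρ ω} → (ω , ρ) ∈ₒ (X -ₒ Y) → ¬ (ω , ρ) ∈ₒ Y
  ∉∖ X Y {ρ} {ω} x-y y with mem X ρ ω | mem Y ρ ω
  ... | true | true = x-y

  ∅ₒ : Obj r
  ∅ₒ = mkObj (λ _ _ → false) 0 (λ _ _ ())

  ∅-≅ : IsEmpty X → ∅ₒ ≅ X
  ∅-≅ X=∅ = ≅-intro (λ _ _ ()) (λ ρ ω x → X=∅ ρ ω x)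

  module _ (u : DisjUnion P Q X) where
    open DisjUnion u

    split-⊆ˡ : P ⊆ₒ X
    split-⊆ˡ ρ ω p = subst T (sym (union ρ ω)) (from T-∨ (inj₁ p))

    split-⊆ʳ : Q ⊆ₒ X
    split-⊆ʳ ρ ω q = subst T (sym (union ρ ω)) (from T-∨ (inj₂ q))

    split-cases : ∀ ρ ω → (ω , ρ) ∈ₒ X → (ω , ρ) ∈ₒ P ⊎ (ω , ρ) ∈ₒ Q
    split-cases ρ ω x = to T-∨ (subst T (union ρ ω) x)

  split-intro : Disjoint P Q → P ⊆ₒ X → Q ⊆ₒ X →
                (∀ ρ ω → (ω , ρ) ∈ₒ X → (ω , ρ) ∈ₒ P ⊎ (ω , ρ) ∈ₒ Q) → DisjUnion P Q X
  split-intro P⊥Q P⊆X Q⊆X cover =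
    mkDU P⊥Q λ ρ ω → T-ext (from T-∨ ∘ cover ρ ω) ([ P⊆X ρ ω , Q⊆X ρ ω ] ∘ to T-∨)

  complement-split : Y ⊆ₒ X → DisjUnion Y (X -ₒ Y) X
  complement-split {Y = Y} {X = X} Y⊆X =
    split-intro (λ _ _ y y∉ → ∉∖ X Y y∉ y) Y⊆X (λ _ _ → ∈∖ˡ X Y) cover
    where
    cover : ∀ ρ ω → (ω , ρ) ∈ₒ X → (ω , ρ) ∈ₒ Y ⊎ (ω , ρ) ∈ₒ (X -ₒ Y)
    cover ρ ω x with T? (mem Y ρ ω)
    ... | yes y  = inj₁ y
    ... | no  y∉ = inj₂ (∈∖ X Y x y∉)

  swap-split : DisjUnion P Q X → DisjUnion Q P X
  swap-split u =
    split-intro (λ ρ ω q p → DisjUnion.disj u ρ ω p q) (split-⊆ʳ u) (split-⊆ˡ u)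
                (λ ρ ω → swap ∘ split-cases u ρ ω)

  restrict-split : Y ⊆ₒ X → DisjUnion P Q X → DisjUnion (Y ∩ₒ P) (Y ∩ₒ Q) Y
  restrict-split {Y = Y} {P = P} {Q = Q} Y⊆X u =
    split-intro (λ ρ ω p q → DisjUnion.disj u ρ ω (∈∩ʳ Y P p) (∈∩ʳ Y Q q))
                (λ _ _ → ∈∩ˡ Y P) (λ _ _ → ∈∩ˡ Y Q)
                (λ ρ ω y → Sum.map (∈∩ Y P y) (∈∩ Y Q y) (split-cases u ρ ω (Y⊆X ρ ω y)))

  transport-split : DisjUnion P Q X → P ≅ P' → Q ≅ Q' → X ≅ X' → DisjUnion P' Q' X'
  transport-split u eP eQ eX =
    split-intro (λ ρ ω p q → DisjUnion.disj u ρ ω (⊆← eP ρ ω p) (⊆← eQ ρ ω q))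
                (λ ρ ω → ⊆→ eX ρ ω ∘ split-⊆ˡ u ρ ω ∘ ⊆← eP ρ ω)
                (λ ρ ω → ⊆→ eX ρ ω ∘ split-⊆ʳ u ρ ω ∘ ⊆← eQ ρ ω)
                (λ ρ ω → Sum.map (⊆→ eP ρ ω) (⊆→ eQ ρ ω) ∘ split-cases u ρ ω ∘ ⊆← eX ρ ω)

  ∩-absorb : P ⊆ₒ A → P ≅ A ∩ₒ P
  ∩-absorb {P = P} {A = A} P⊆A = ≅-intro (λ ρ ω p → ∈∩ A P (P⊆A ρ ω p) p) (λ _ _ → ∈∩ʳ A P)

  ∩-assoc-absorb : B ⊆ₒ D → B ∩ₒ (D ∩ₒ P) ≅ B ∩ₒ P
  ∩-assoc-absorb {B = B} {D = D} {P = P} B⊆D = ≅-intro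
    (λ _ _ x → ∈∩ B P (∈∩ˡ B (D ∩ₒ P) x) (∈∩ʳ D P (∈∩ʳ B (D ∩ₒ P) x)))
    (λ ρ ω x → let b = ∈∩ˡ B P x in ∈∩ B (D ∩ₒ P) b (∈∩ D P (B⊆D ρ ω b) (∈∩ʳ B P x)))

  ∩-congˡ : X ≅ X' → X ∩ₒ P ≅ X' ∩ₒ P
  ∩-congˡ {X = X} {X' = X'} {P = P} e = ≅-intro
    (λ ρ ω x → ∈∩ X' P (⊆→ e ρ ω (∈∩ˡ X P x)) (∈∩ʳ X P x))
    (λ ρ ω x → ∈∩ X P (⊆← e ρ ω (∈∩ˡ X' P x)) (∈∩ʳ X' P x))

  ∖-congˡ : X ≅ X' → X -ₒ A ≅ X' -ₒ A
  ∖-congˡ {X = X} {X' = X'} {A = A} e = ≅-intro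
    (λ ρ ω x → ∈∖ X' A (⊆→ e ρ ω (∈∖ˡ X A x)) (∉∖ X A x))
    (λ ρ ω x → ∈∖ X A (⊆← e ρ ω (∈∖ˡ X' A x)) (∉∖ X' A x))

  ∖-swap : (X -ₒ A) -ₒ B ≅ (X -ₒ B) -ₒ A
  ∖-swap {X = X} {A = A} {B = B} = ≅-intro (∖-comm A B) (∖-comm B A)
    where
    ∖-comm : ∀ (A B : Obj r) → ((X -ₒ A) -ₒ B) ⊆ₒ ((X -ₒ B) -ₒ A)
    ∖-comm A B _ _ x =
      let x∈X∖A = ∈∖ˡ (X -ₒ A) B x
      in ∈∖ (X -ₒ B) A (∈∖ X B (∈∖ˡ X A x∈X∖A) (∉∖ (X -ₒ A) B x)) (∉∖ X A x∈X∖A)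

  split-complementˡ : DisjUnion P Q A → A ⊆ₒ X → Q ≅ A ∩ₒ (X -ₒ P)
  split-complementˡ {P = P} {Q = Q} {A = A} {X = X} u A⊆X = ≅-intro
    (λ ρ ω q → let a = split-⊆ʳ u ρ ω q
               in ∈∩ A (X -ₒ P) a (∈∖ X P (A⊆X ρ ω a) (λ p → DisjUnion.disj u ρ ω p q)))
    (λ ρ ω x → [ ⊥-elim ∘ ∉∖ X P (∈∩ʳ A (X -ₒ P) x) , id ]
                 (split-cases u ρ ω (∈∩ˡ A (X -ₒ P) x)))

  split-complementʳ : DisjUnion P Q A → A ⊆ₒ X → P ≅ A ∩ₒ (X -ₒ Q)
  split-complementʳ {X = X} u = split-complementˡ {X = X} (swap-split u)

  ∩-empty : P ⊆ₒ A → Disjoint A B → IsEmpty (B ∩ₒ P)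
  ∩-empty {P = P} {B = B} P⊆A A⊥B ρ ω x = A⊥B ρ ω (P⊆A ρ ω (∈∩ʳ B P x)) (∈∩ˡ B P x)

  ∖-⊆ : A ⊆ₒ X → B ⊆ₒ (X -ₒ A) → A ⊆ₒ (X -ₒ B)
  ∖-⊆ {A = A} {X = X} {B = B} A⊆X B⊆X∖A ρ ω a =
    ∈∖ X B (A⊆X ρ ω a) (λ b → ∉∖ X A (B⊆X∖A ρ ω b) a)

module _ {r : ℕ} (Sp : Species r) where
  open Species Sp

  private variable
    X Y Z : Obj r

  Elem-≡ : ∀ {ρ} {e e' : Elem X ρ} → proj₁ e ≡ proj₁ e' → e ≡ e'
  Elem-≡ {X} {ρ} {ω , p} {.ω , p'} refl = cong (ω ,_) (T-irrelevant p p')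

  ≈H-labels : {f g : Hom X Y} → (∀ ρ e → proj₁ (app f ρ e) ≡ proj₁ (app g ρ e)) → f ≈H g
  ≈H-labels {Y = Y} same ρ e = Elem-≡ {Y} (same ρ e)

  relabel : X ⊆ₒ Y → ∀ ρ → Elem X ρ → Elem Y ρ
  relabel X⊆Y ρ e = proj₁ e , X⊆Y ρ (proj₁ e) (proj₂ e)

  trH : X ≅ Y → Hom X Y
  trH {X} {Y} e = mkHom λ ρ → mk↔ₛ′ (relabel {X} {Y} (⊆→ e) ρ) (relabel {Y} {X} (⊆← e) ρ)
                                    (λ _ → Elem-≡ {Y} refl) (λ _ → Elem-≡ {X} refl)

  tr : X ≅ Y → F₀ X → F₀ Y
  tr e = F₁ (trH e)

  tr-id : (e : X ≅ X) (x : F₀ X) → tr e x ≡ x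
  tr-id {X} e x = trans (F-cong (≈H-labels {f = trH e} {g = idH X} λ _ _ → refl) x) (F-id x)

  tr-∘ : (e : X ≅ Y) (e' : Y ≅ Z) (e'' : X ≅ Z) (x : F₀ X) → tr e' (tr e x) ≡ tr e'' x
  tr-∘ e e' e'' x = trans (sym (F-∘ (trH e) (trH e') x))
                          (F-cong (≈H-labels {f = trH e' ∘H trH e} {g = trH e''} λ _ _ → refl) x)

  tr-back : (e : X ≅ Y) (x : F₀ X) → tr (≅-sym e) (tr e x) ≡ x
  tr-back {X} e x = trans (tr-∘ e (≅-sym e) ≅-refl x) (tr-id (≅-refl {X = X}) x)

  tr-injective : (e : X ≅ Y) → Injective _≡_ _≡_ (tr e)
  tr-injective e {x} {y} tx≡ty =
    trans (sym (tr-back e x)) (trans (cong (tr (≅-sym e)) tx≡ty) (tr-back e y))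

  module _ (C : CompOp Sp) where
    open CompOp C

    private variable
      A B D E P Q P' Q' X' : Obj r

    η-transport : (v : DisjUnion P Q X) (v' : DisjUnion P' Q' X')
                  (eP : P ≅ P') (eQ : Q ≅ Q') (eX : X ≅ X') (p : F₀ P) (q : F₀ Q) →
                  η v' (tr eP p) (tr eQ q) ≡ tr eX (η v p q)
    η-transport v v' eP eQ eX =
      η-nat v v' (trH eP) (trH eQ) (trH eX) (λ _ _ _ _ → refl) (λ _ _ _ _ → refl)

    Splits : (P Q X : Obj r) → F₀ X → Set
    Splits P Q X = ImgAny Sp C P Q X (λ _ → ⊤) (λ _ → ⊤)

    splits-intro : (u : DisjUnion P Q X) {x : F₀ X} {p : F₀ P} {q : F₀ Q} →
                   x ≡ η u p q → Splits P Q X x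
    splits-intro u {p = p} {q} x≡ = u , p , q , tt , tt , x≡

    factors : {x : F₀ X} → Splits P Q X x → (u : DisjUnion P' Q' X) → P ≅ P' → Q ≅ Q' →
              Σ[ p ∈ F₀ P' ] Σ[ q ∈ F₀ Q' ] x ≡ η u p q
    factors {X = X} {x = x} (v , p , q , _ , _ , x≡) u eP eQ = tr eP p , tr eQ q , (begin
      x                         ≡⟨ x≡ ⟩
      η v p q                   ≡⟨ tr-id ≅-refl (η v p q) ⟨
      tr ≅-refl (η v p q)       ≡⟨ η-transport v u eP eQ (≅-refl {X = X}) p q ⟨
      η u (tr eP p) (tr eQ q)   ∎)
      where open ≡-Reasoning

    Splits-cong : {x : F₀ X} → P ≅ P' → Q ≅ Q' → Splits P Q X x ⇔ Splits P' Q' X x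
    Splits-cong eP eQ = mk⇔ (move eP eQ) (move (≅-sym eP) (≅-sym eQ))
      where
      move : ∀ {P Q P' Q' x} → P ≅ P' → Q ≅ Q' → Splits P Q X x → Splits P' Q' X x
      move eP eQ s@(v , _) =
        let u = transport-split v eP eQ ≅-refl ; (_ , _ , x≡) = factors s u eP eQ
        in splits-intro u x≡

    Splits-transport : {x : F₀ X} (eX : X ≅ X') → P ≅ P' → Q ≅ Q' →
                       Splits P Q X x ⇔ Splits P' Q' X' (tr eX x)
    Splits-transport {x = x} eX eP eQ =
      mk⇔ (move eX eP eQ)
          (subst (Splits _ _ _) (tr-back eX x) ∘ move (≅-sym eX) (≅-sym eP) (≅-sym eQ))
      where
      move : ∀ {X X' P Q P' Q' x} (eX : X ≅ X') → P ≅ P' → Q ≅ Q' →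
             Splits P Q X x → Splits P' Q' X' (tr eX x)
      move eX eP eQ (v , p , q , _ , _ , x≡) =
        let u = transport-split v eP eQ eX
        in splits-intro u (trans (cong (tr eX) x≡) (sym (η-transport v u eP eQ eX p q)))

    η-restrict : (u : DisjUnion A B X) {x : F₀ X} {a : F₀ A} {b : F₀ B} → x ≡ η u a b →
                 Splits P Q X x →
                 Splits (A ∩ₒ P) (A ∩ₒ Q) A a × Splits (B ∩ₒ P) (B ∩ₒ Q) B b
    η-restrict u {a = a} {b} x≡ (w , x∈w)
      with proj₁ (D1 u w (restrict-split (split-⊆ˡ u) w) (restrict-split (split-⊆ʳ u) w) _)
                 ((a , b , tt , tt , x≡) , x∈w)
    ... | a₀ , b₀ , (_ , _ , _ , _ , a₀≡) , (_ , _ , _ , _ , b₀≡) , x≡₀ =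
      let (a≡a₀ , b≡b₀) = η-inj u (trans (sym x≡) x≡₀)
      in splits-intro _ (trans a≡a₀ a₀≡) , splits-intro _ (trans b≡b₀ b₀≡)

    -- The converse (extension) needs a witness of X = P ∐ Q.
    η-profile : (u : DisjUnion A B X) {x : F₀ X} {a : F₀ A} {b : F₀ B} → x ≡ η u a b →
                DisjUnion P Q X →
                Splits P Q X x ⇔ (Splits (A ∩ₒ P) (A ∩ₒ Q) A a × Splits (B ∩ₒ P) (B ∩ₒ Q) B b)
    η-profile {A = A} {B = B} {X = X} {P = P} {Q = Q} u {x} {a} {b} x≡ w =
      mk⇔ (η-restrict u x≡) extend
      where
      uA : DisjUnion (A ∩ₒ P) (A ∩ₒ Q) A
      uA = restrict-split (split-⊆ˡ u) w

      uB : DisjUnion (B ∩ₒ P) (B ∩ₒ Q) B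
      uB = restrict-split (split-⊆ʳ u) w

      extend : Splits (A ∩ₒ P) (A ∩ₒ Q) A a × Splits (B ∩ₒ P) (B ∩ₒ Q) B b → Splits P Q X x
      extend (a-splits , b-splits) =
        let (a₁ , a₂ , a≡) = factors a-splits uA ≅-refl ≅-refl
            (b₁ , b₂ , b≡) = factors b-splits uB ≅-refl ≅-refl
        in w , proj₂ (proj₂ (D1 u w uA uB x)
                        (a , b , (a₁ , a₂ , tt , tt , a≡) , (b₁ , b₂ , tt , tt , b≡) , x≡))

    η-profile₃ : (u : DisjUnion A D X) (u' : DisjUnion B E D)
                 {z : F₀ X} {a : F₀ A} {b : F₀ D} {a' : F₀ B} {b' : F₀ E} →
                 z ≡ η u a b → b ≡ η u' a' b' → DisjUnion P Q X →
                 Splits P Q X z ⇔ (Splits (A ∩ₒ P) (A ∩ₒ Q) A a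
                                  × Splits (B ∩ₒ P) (B ∩ₒ Q) B a'
                                  × Splits (E ∩ₒ P) (E ∩ₒ Q) E b')
    η-profile₃ {D = D} {B = B} {E = E} {P = P} {Q = Q} u u' z≡ b≡ w =
      (⇔-id _ ×-⇔ (trace B (split-⊆ˡ u') ×-⇔ trace E (split-⊆ʳ u'))
                  ⇔-∘ η-profile u' b≡ (restrict-split (split-⊆ʳ u) w))
      ⇔-∘ η-profile u z≡ w
      where
      trace : ∀ B {y} → B ⊆ₒ D →
              Splits (B ∩ₒ (D ∩ₒ P)) (B ∩ₒ (D ∩ₒ Q)) B y ⇔ Splits (B ∩ₒ P) (B ∩ₒ Q) B y
      trace B B⊆D = Splits-cong (∩-assoc-absorb {B = B} {D = D} {P = P} B⊆D)
                                (∩-assoc-absorb {B = B} {D = D} {P = Q} B⊆D)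

    -- F[∅] is inhabited as soon as η has a nonempty image: restricting
    -- x = η(a, b) to its own splitting A ∐ B splits a along A ∐ (A ∩ B),
    -- and A ∩ B is empty.
    empty-structure : (u : DisjUnion A B X) {x : F₀ X} {a : F₀ A} {b : F₀ B} →
                      x ≡ η u a b → F₀ ∅ₒ
    empty-structure {A = A} {B = B} u x≡ with proj₁ (η-restrict u x≡ (splits-intro u x≡))
    ... | _ , _ , e , _ =
      tr (≅-sym (∅-≅ λ ρ ω ab → DisjUnion.disj u ρ ω (∈∩ˡ A B ab) (∈∩ʳ A B ab))) e

    -- x ⊑ y: every splitting of x is a splitting of y.  Elements with the same
    -- splittings (x ≋ y) cannot be told apart by F_η and F^(k)_η.
    _⊑_ : {X : Obj r} → F₀ X → F₀ X → Set
    _⊑_ {X} x y = ∀ P Q → Splits P Q X x → Splits P Q X y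

    _≋_ : {X : Obj r} → F₀ X → F₀ X → Set
    x ≋ y = x ⊑ y × y ⊑ x

    Fη-⊑ : {x y : F₀ X} → Fη Sp C X x → y ⊑ x → Fη Sp C X y
    Fη-⊑ (X≠∅ , no-split) y⊑x =
      X≠∅ , λ (P , Q , P≠∅ , Q≠∅ , y-splits) → no-split (P , Q , P≠∅ , Q≠∅ , y⊑x P Q y-splits)

    Fk-transport : ∀ k {x : F₀ X} (e : X ≅ X') → Fk Sp C k X x → Fk Sp C k X' (tr e x)
    Fk-transport zero    e X=∅ ρ ω x' = X=∅ ρ ω (⊆← e ρ ω x')
    Fk-transport {X = X} {X' = X'} (suc k) {x} e (A , A⊆X , u , a , b , a∈ , b∈ , x≡) =
      A , (λ ρ ω → ⊆→ e ρ ω ∘ A⊆X ρ ω) , u' , a , tr e' b , a∈ , Fk-transport k e' b∈ , (begin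
        tr e x                           ≡⟨ cong (tr e) x≡ ⟩
        tr e (η u a b)                   ≡⟨ η-transport u u' ≅-refl e' e a b ⟨
        η u' (tr ≅-refl a) (tr e' b)     ≡⟨ cong (λ a → η u' a (tr e' b)) (tr-id ≅-refl a) ⟩
        η u' a (tr e' b)                 ∎)
      where
      open ≡-Reasoning
      e' : (X -ₒ A) ≅ (X' -ₒ A)
      e' = ∖-congˡ {A = A} e

      u' : DisjUnion A (X' -ₒ A) X'
      u' = transport-split u ≅-refl e' e

    Piece : ℕ → (Ω Ω₁ : Obj r) → F₀ Ω → Set
    Piece k Ω Ω₁ = ImgAny Sp C Ω₁ (Ω -ₒ Ω₁) Ω (Fη Sp C Ω₁) (Fk Sp C k (Ω -ₒ Ω₁))

    -- If z = η(a, b) along Ω = Ω₁ ∐ (Ω - Ω₁) also splits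
    -- along Ω₁' ∐ (Ω - Ω₁'), then a splits along Ω₁ ∩ Ω₁' ∐ Ω₁ ∩ (Ω - Ω₁').  The
    -- first part contains the base point, so as a is indecomposable the second
    -- one is empty: Ω₁ ⊆ Ω₁'.
    piece-⊆ : ∀ {k Ω Ω₁ Ω₁' ω ρ} {z : F₀ Ω} → (ω , ρ) ∈ₒ Ω₁ → (ω , ρ) ∈ₒ Ω₁' → Ω₁ ⊆ₒ Ω →
              Piece k Ω Ω₁ z → Splits Ω₁' (Ω -ₒ Ω₁') Ω z → Ω₁ ⊆ₒ Ω₁'
    piece-⊆ {Ω = Ω} {Ω₁} {Ω₁'} {ω} {ρ} base base' Ω₁⊆Ω (u , _ , _ , (_ , a-indec) , _ , z≡)
            z-splits' ρ' ω' x with T? (mem Ω₁' ρ' ω')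
    ... | yes x∈Ω₁' = x∈Ω₁'
    ... | no  x∉Ω₁' = ⊥-elim (a-indec
      ( Ω₁ ∩ₒ Ω₁' , Ω₁ ∩ₒ (Ω -ₒ Ω₁')
      , (λ Ω₁∩Ω₁'=∅ → Ω₁∩Ω₁'=∅ ρ ω (∈∩ Ω₁ Ω₁' base base'))
      , (λ rest=∅ → rest=∅ ρ' ω' (∈∩ Ω₁ (Ω -ₒ Ω₁') x (∈∖ Ω Ω₁' (Ω₁⊆Ω ρ' ω' x) x∉Ω₁')))
      , proj₁ (η-restrict u z≡ z-splits')))

    piece-splits : ∀ {k Ω Ω₁} {z : F₀ Ω} → Piece k Ω Ω₁ z → Splits Ω₁ (Ω -ₒ Ω₁) Ω z
    piece-splits (u , _ , _ , _ , _ , z≡) = splits-intro u z≡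

    pieces-disjoint : ∀ {k Ω Ω₁ Ω₁' ω ρ} {z : F₀ Ω} →
                      (ω , ρ) ∈ₒ Ω₁ → Ω₁ ⊆ₒ Ω → (ω , ρ) ∈ₒ Ω₁' → Ω₁' ⊆ₒ Ω →
                      Piece k Ω Ω₁ z → Piece k Ω Ω₁' z → Ω₁ ≐ Ω₁'
    pieces-disjoint {Ω₁ = Ω₁} {Ω₁'} base Ω₁⊆Ω base' Ω₁'⊆Ω piece piece' =
      ≅⇒≐ {X = Ω₁} {Y = Ω₁'} (≅-intro
      (piece-⊆ base base' Ω₁⊆Ω piece (piece-splits piece'))
      (piece-⊆ base' base Ω₁'⊆Ω piece' (piece-splits piece)))

    module _ (e₀ : F₀ ∅ₒ) where

      -- If g : F[Y] → F[P] × F[Q] is injective, then y ↦ η(g y) is an injective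
      -- endomap of the finite set F[Y], hence onto: every y splits along P ∐ Q.
      splits-everywhere : (u : DisjUnion P Q Y) (g : F₀ Y → F₀ P × F₀ Q) →
                          Injective _≡_ _≡_ g → ∀ y → Splits P Q Y y
      splits-everywhere {Y = Y} u g g-inj y =
        let (_ , ηg≡y) = finite-injective⇒surjective (proj₂ (F-fin Y)) ηg ηg-inj y
        in splits-intro u (sym ηg≡y)
        where
        ηg : F₀ Y → F₀ Y
        ηg y = η u (proj₁ (g y)) (proj₂ (g y))

        ηg-inj : Injective _≡_ _≡_ ηg
        ηg-inj = g-inj ∘ ×-≡,≡→≡ ∘ η-inj u

      -- Hence every element splits along ∅ ∐ Y and along Y ∐ ∅, with (a
      -- transport of) e₀ as the factor on the empty part.
      splits-emptyˡ : IsEmpty E → DisjUnion E Q Y → ∀ y → Splits E Q Y y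
      splits-emptyˡ {Q = Q} {Y = Y} E=∅ u =
        splits-everywhere u (λ y → tr (∅-≅ E=∅) e₀ , tr Y≅Q y) (tr-injective Y≅Q ∘ ,-injectiveʳ)
        where
        Y≅Q : Y ≅ Q
        Y≅Q = ≅-intro (λ ρ ω y → [ ⊥-elim ∘ E=∅ ρ ω , id ] (split-cases u ρ ω y)) (split-⊆ʳ u)

      splits-emptyʳ : IsEmpty E → DisjUnion P E Y → ∀ y → Splits P E Y y
      splits-emptyʳ {P = P} {Y = Y} E=∅ u =
        splits-everywhere u (λ y → tr Y≅P y , tr (∅-≅ E=∅) e₀) (tr-injective Y≅P ∘ ,-injectiveˡ)
        where
        Y≅P : Y ≅ P
        Y≅P = ≅-intro (λ ρ ω y → [ id , ⊥-elim ∘ E=∅ ρ ω ] (split-cases u ρ ω y)) (split-⊆ˡ u)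

      -- The splittings of the left factor a of x = η(a, b) along X = A ∐ B are
      -- the splittings P ∐ (X - P) of x with P ⊆ A; the right factor b then
      -- splits along ∅ ∐ B.
      profileˡ : (u : DisjUnion A B X) {x : F₀ X} {a : F₀ A} {b : F₀ B} → x ≡ η u a b →
                 DisjUnion P Q A → Splits P Q A a ⇔ Splits P (X -ₒ P) X x
      profileˡ {A = A} {B = B} {X = X} {P = P} {Q = Q} u {x} {a} {b} x≡ v =
        mk⇔ (λ a-splits → from traces (to traces-a a-splits , b-splits))
            (from traces-a ∘ proj₁ ∘ to traces)
        where
        P⊆A : P ⊆ₒ A
        P⊆A = split-⊆ˡ v

        w : DisjUnion P (X -ₒ P) X
        w = complement-split (λ ρ ω → split-⊆ˡ u ρ ω ∘ P⊆A ρ ω)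

        traces : Splits P (X -ₒ P) X x ⇔
                 (Splits (A ∩ₒ P) (A ∩ₒ (X -ₒ P)) A a × Splits (B ∩ₒ P) (B ∩ₒ (X -ₒ P)) B b)
        traces = η-profile u x≡ w

        traces-a : Splits P Q A a ⇔ Splits (A ∩ₒ P) (A ∩ₒ (X -ₒ P)) A a
        traces-a = Splits-cong (∩-absorb {P = P} {A = A} P⊆A)
                               (split-complementˡ {X = X} v (split-⊆ˡ u))

        b-splits : Splits (B ∩ₒ P) (B ∩ₒ (X -ₒ P)) B b
        b-splits = splits-emptyˡ (∩-empty {P = P} {A = A} {B = B} P⊆A (DisjUnion.disj u))
                                 (restrict-split (split-⊆ʳ u) w) b

      profileʳ : (u : DisjUnion A B X) {x : F₀ X} {a : F₀ A} {b : F₀ B} → x ≡ η u a b →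
                 DisjUnion P Q B → Splits P Q B b ⇔ Splits (X -ₒ Q) Q X x
      profileʳ {A = A} {B = B} {X = X} {P = P} {Q = Q} u {x} {a} {b} x≡ v =
        mk⇔ (λ b-splits → from traces (a-splits , to traces-b b-splits))
            (from traces-b ∘ proj₂ ∘ to traces)
        where
        Q⊆B : Q ⊆ₒ B
        Q⊆B = split-⊆ʳ v

        w : DisjUnion (X -ₒ Q) Q X
        w = swap-split (complement-split (λ ρ ω → split-⊆ʳ u ρ ω ∘ Q⊆B ρ ω))

        traces : Splits (X -ₒ Q) Q X x ⇔
                 (Splits (A ∩ₒ (X -ₒ Q)) (A ∩ₒ Q) A a × Splits (B ∩ₒ (X -ₒ Q)) (B ∩ₒ Q) B b)
        traces = η-profile u x≡ w

        traces-b : Splits P Q B b ⇔ Splits (B ∩ₒ (X -ₒ Q)) (B ∩ₒ Q) B b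
        traces-b = Splits-cong (split-complementʳ {X = X} v (split-⊆ʳ u))
                               (∩-absorb {P = Q} {A = B} Q⊆B)

        a-splits : Splits (A ∩ₒ (X -ₒ Q)) (A ∩ₒ Q) A a
        a-splits = splits-emptyʳ (∩-empty {P = Q} {A = B} {B = A} Q⊆B
                                           (λ ρ ω b a → DisjUnion.disj u ρ ω a b))
                                 (restrict-split (split-⊆ˡ u) w) a

      factors-⊑ : (u : DisjUnion A B X) {x x' : F₀ X} {a a' : F₀ A} {b b' : F₀ B} →
                  x ≡ η u a b → x' ≡ η u a' b' → x' ⊑ x → a' ⊑ a × b' ⊑ b
      factors-⊑ u x≡ x'≡ x'⊑x =
        (λ _ _ a'-splits@(v , _) →
           from (profileˡ u x≡ v) (x'⊑x _ _ (to (profileˡ u x'≡ v) a'-splits))) ,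
        (λ _ _ b'-splits@(v , _) →
           from (profileʳ u x≡ v) (x'⊑x _ _ (to (profileʳ u x'≡ v) b'-splits)))

      Fk-≋ : ∀ k {x y : F₀ X} → Fk Sp C k X x → x ≋ y → Fk Sp C k X y
      Fk-≋ zero    X=∅ _ = X=∅
      Fk-≋ (suc k) (A , A⊆X , u , a , b , a∈ , b∈ , x≡) (x⊑y , y⊑x) =
        let (a' , b' , y≡) = factors (x⊑y A _ (splits-intro u x≡)) u ≅-refl ≅-refl
            (a'⊑a , b'⊑b)  = factors-⊑ u x≡ y≡ y⊑x
            (_ , b⊑b')     = factors-⊑ u y≡ x≡ x⊑y
        in A , A⊆X , u , a' , b' , Fη-⊑ a∈ a'⊑a , Fk-≋ k b∈ (b⊑b' , b'⊑b) , y≡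

      -- Let z = η(a, b) along Ω = A ∐ (Ω - A) and b = η(a', b')
      -- along Ω - A = B ∐ ((Ω - A) - B), with a, a' indecomposable and
      -- b' ∈ F^(k)_η.  Put q' = η(a, b') ∈ F^(k+1)_η[Ω - B] and z' = η(a', q').
      -- By η-profile₃, z and z' have the same splittings.  So z = η(p, q) along
      -- Ω = B ∐ (Ω - B), and comparing factors with z', p has only splittings of
      -- a' while q has exactly those of q'.
      regroup : ∀ k {Ω A B : Obj r} (u : DisjUnion A (Ω -ₒ A) Ω)
                {z : F₀ Ω} {a : F₀ A} {b : F₀ (Ω -ₒ A)} → z ≡ η u a b → Fη Sp C A a →
                B ⊆ₒ (Ω -ₒ A) → (u' : DisjUnion B ((Ω -ₒ A) -ₒ B) (Ω -ₒ A))
                {a' : F₀ B} {b' : F₀ ((Ω -ₒ A) -ₒ B)} → b ≡ η u' a' b' →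
                Fη Sp C B a' → Fk Sp C k ((Ω -ₒ A) -ₒ B) b' → Piece (suc k) Ω B z
      regroup k {Ω} {A} {B} u {z} {a} z≡ a∈ B⊆Ω∖A u' {a'} {b'} b≡ a'∈ b'∈ =
        ũ , p , q , Fη-⊑ a'∈ p⊑a' , Fk-≋ (suc k) q'∈ (q'⊑q , q⊑q') , z≡ηpq
        where
        Ω∖A∖B≅Ω∖B∖A : ((Ω -ₒ A) -ₒ B) ≅ ((Ω -ₒ B) -ₒ A)
        Ω∖A∖B≅Ω∖B∖A = ∖-swap {X = Ω} {A = A} {B = B}

        A⊆Ω∖B : A ⊆ₒ (Ω -ₒ B)
        A⊆Ω∖B = ∖-⊆ {A = A} {X = Ω} {B = B} (split-⊆ˡ u) B⊆Ω∖A

        ũ : DisjUnion B (Ω -ₒ B) Ω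
        ũ = complement-split {Y = B} (λ ρ ω → ∈∖ˡ Ω A ∘ B⊆Ω∖A ρ ω)

        v : DisjUnion A ((Ω -ₒ B) -ₒ A) (Ω -ₒ B)
        v = complement-split {Y = A} A⊆Ω∖B

        q' : F₀ (Ω -ₒ B)
        q' = η v a (tr Ω∖A∖B≅Ω∖B∖A b')

        q'∈ : Fk Sp C (suc k) (Ω -ₒ B) q'
        q'∈ = A , A⊆Ω∖B , v , a , tr Ω∖A∖B≅Ω∖B∖A b' , a∈ ,
              Fk-transport k Ω∖A∖B≅Ω∖B∖A b'∈ , refl

        z' : F₀ Ω
        z' = η ũ a' q'

        same-splittings : ∀ {P Q} → DisjUnion P Q Ω → Splits P Q Ω z ⇔ Splits P Q Ω z'
        same-splittings {P} {Q} w =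
          ⇔-sym (η-profile₃ ũ v refl refl w) ⇔-∘ (reorder b'-trace ⇔-∘ η-profile₃ u u' z≡ b≡ w)
          where
          b'-trace : Splits (((Ω -ₒ A) -ₒ B) ∩ₒ P) (((Ω -ₒ A) -ₒ B) ∩ₒ Q) ((Ω -ₒ A) -ₒ B) b' ⇔
                     Splits (((Ω -ₒ B) -ₒ A) ∩ₒ P) (((Ω -ₒ B) -ₒ A) ∩ₒ Q) ((Ω -ₒ B) -ₒ A)
                            (tr Ω∖A∖B≅Ω∖B∖A b')
          b'-trace = Splits-transport Ω∖A∖B≅Ω∖B∖A (∩-congˡ {P = P} Ω∖A∖B≅Ω∖B∖A)
                                                  (∩-congˡ {P = Q} Ω∖A∖B≅Ω∖B∖A)

          reorder : ∀ {A₁ A₂ B₁ B₂ : Set} → B₁ ⇔ B₂ → (A₁ × A₂ × B₁) ⇔ (A₂ × A₁ × B₂)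
          reorder B₁⇔B₂ = mk⇔ (λ (a₁ , a₂ , b₁) → a₂ , a₁ , to B₁⇔B₂ b₁)
                              (λ (a₂ , a₁ , b₂) → a₁ , a₂ , from B₁⇔B₂ b₂)

        z⊑z' : z ⊑ z'
        z⊑z' _ _ z-splits@(w , _) = to (same-splittings w) z-splits

        z'⊑z : z' ⊑ z
        z'⊑z _ _ z'-splits@(w , _) = from (same-splittings w) z'-splits

        along-ũ : Σ[ p ∈ F₀ B ] Σ[ q ∈ F₀ (Ω -ₒ B) ] z ≡ η ũ p q
        along-ũ = factors (z'⊑z B (Ω -ₒ B) (splits-intro ũ refl)) ũ ≅-refl ≅-refl

        p : F₀ B
        p = proj₁ along-ũ

        q : F₀ (Ω -ₒ B)
        q = proj₁ (proj₂ along-ũ)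

        z≡ηpq : z ≡ η ũ p q
        z≡ηpq = proj₂ (proj₂ along-ũ)

        p⊑a' : p ⊑ a'
        p⊑a' = proj₁ (factors-⊑ ũ refl z≡ηpq z⊑z')

        q⊑q' : q ⊑ q'
        q⊑q' = proj₂ (factors-⊑ ũ refl z≡ηpq z⊑z')

        q'⊑q : q' ⊑ q
        q'⊑q = proj₂ (factors-⊑ ũ z≡ηpq refl z'⊑z)

      -- If the base point is not in the first part A
      -- of z = η(a, b), it lies in Ω - A; then b ∈ F^(k)_η[Ω - A] forces k > 0,
      -- b has such a decomposition by induction, and regrouping moves its first
      -- part to the front.
      cover : ∀ k {Ω : Obj r} {ω ρ} → (ω , ρ) ∈ₒ Ω → (z : F₀ Ω) → Fk Sp C (suc k) Ω z →
              Σ[ Ω₁ ∈ Obj r ] ((ω , ρ) ∈ₒ Ω₁ × Ω₁ ⊆ₒ Ω × Piece k Ω Ω₁ z)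
      cover k {Ω} {ω} {ρ} base z (A , A⊆Ω , piece@(u , a , b , a∈ , b∈ , z≡))
        with T? (mem A ρ ω)
      ... | yes base∈A = A , base∈A , A⊆Ω , piece
      ... | no  base∉A = shift k b∈
        where
        base∈Ω∖A : (ω , ρ) ∈ₒ (Ω -ₒ A)
        base∈Ω∖A = ∈∖ Ω A base base∉A

        shift : ∀ k → Fk Sp C k (Ω -ₒ A) b →
                Σ[ B ∈ Obj r ] ((ω , ρ) ∈ₒ B × B ⊆ₒ Ω × Piece k Ω B z)
        shift zero    Ω∖A=∅ = ⊥-elim (Ω∖A=∅ ρ ω base∈Ω∖A)
        shift (suc k) b∈ with cover k base∈Ω∖A b b∈
        ... | B , base∈B , B⊆Ω∖A , u' , a' , b' , a'∈ , b'∈ , b≡ =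
          B , base∈B , (λ ρ ω → ∈∖ˡ Ω A ∘ B⊆Ω∖A ρ ω) , regroup k u z≡ a∈ B⊆Ω∖A u' b≡ a'∈ b'∈

lemma5p4 : (r : ℕ) → 0 < r → (S : Species r) →
    (nonempty : Σ[ Θ ∈ Obj r ] Species.F₀ S Θ) → (C : CompOp S) →
    let open Species S
    in (Ω : Obj r) → ¬ IsEmpty Ω → (ω : ℕ) (ρ : Fin r) → (ω , ρ) ∈ₒ Ω →
       (k : ℕ) →
       ((z : F₀ Ω) →
          (Fk S C (suc k) Ω z →
             Σ[ Ω₁ ∈ Obj r ] ((ω , ρ) ∈ₒ Ω₁ × Ω₁ ⊆ₒ Ω ×
               ImgAny S C Ω₁ (Ω -ₒ Ω₁) Ω (Fη S C Ω₁) (Fk S C k (Ω -ₒ Ω₁)) z))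
          × (Σ[ Ω₁ ∈ Obj r ] ((ω , ρ) ∈ₒ Ω₁ × Ω₁ ⊆ₒ Ω ×
               ImgAny S C Ω₁ (Ω -ₒ Ω₁) Ω (Fη S C Ω₁) (Fk S C k (Ω -ₒ Ω₁)) z) →
             Fk S C (suc k) Ω z))
       × ((Ω₁ Ω₁' : Obj r) → (ω , ρ) ∈ₒ Ω₁ → Ω₁ ⊆ₒ Ω →
          (ω , ρ) ∈ₒ Ω₁' → Ω₁' ⊆ₒ Ω → (z : F₀ Ω) →
          ImgAny S C Ω₁ (Ω -ₒ Ω₁) Ω (Fη S C Ω₁) (Fk S C k (Ω -ₒ Ω₁)) z →
          ImgAny S C Ω₁' (Ω -ₒ Ω₁') Ω (Fη S C Ω₁') (Fk S C k (Ω -ₒ Ω₁')) z →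
          Ω₁ ≐ Ω₁')
lemma5p4 r _ S _ C Ω _ ω ρ base k =
  (λ z → covered z , forget-base-point) ,
  (λ Ω₁ Ω₁' base∈Ω₁ Ω₁⊆Ω base∈Ω₁' Ω₁'⊆Ω z → pieces-disjoint S C base∈Ω₁ Ω₁⊆Ω base∈Ω₁' Ω₁'⊆Ω)
  where
  -- F[∅] is inhabited by the decomposition z = η(a, b) witnessing z ∈ F^(k+1)_η[Ω].
  covered : ∀ z → Fk S C (suc k) Ω z →
            Σ[ Ω₁ ∈ Obj r ] ((ω , ρ) ∈ₒ Ω₁ × Ω₁ ⊆ₒ Ω × Piece S C k Ω Ω₁ z)
  covered z z∈@(_ , _ , u , _ , _ , _ , _ , z≡) = cover S C (empty-structure S C u z≡) k base z z∈

  forget-base-point : ∀ {z} → Σ[ Ω₁ ∈ Obj r ] ((ω , ρ) ∈ₒ Ω₁ × Ω₁ ⊆ₒ Ω × Piece S C k Ω Ω₁ z) →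
                      Fk S C (suc k) Ω z
  forget-base-point (Ω₁ , _ , Ω₁⊆Ω , piece) = Ω₁ , Ω₁⊆Ω , piece
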